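{- Let $(\mathcal G_1,e_1)$ and $(\mathcal G_2,e_2)$ be rooted graphs, and let $\mathcal B_1,\mathcal B_2$ be the branches of $\mathcal G_1*\mathcal G_2$ subordinate to $\mathcal G_1$ and $\mathcal G_2$. Define rooted graphs recursively by $\mathcal G_1\vdash_1\mathcal G_2=\mathcal G_1\vdash\mathcal G_2$ and $\mathcal G_1\vdash_m\mathcal G_2=\mathcal G_1\vdash(\mathcal G_2\vdash_{m-1}\mathcal G_1)$ for $m>1$, and symmetrically $\mathcal G_2\vdash_m\mathcal G_1$. Then $(\mathcal B_1,e)$ is isomorphic, as a rooted graph, to the inductive limit $\mathcal L_1$ of the chain $\mathcal G_1\vdash_1\mathcal G_2\subset\mathcal G_1\vdash_2\mathcal G_2\subset\cdots$, and analogously $(\mathcal B_2,e)$ is isomorphic to the inductive limit $\mathcal L_2$ of the chain $\mathcal G_2\vdash_m\mathcal G_1$.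
   Context: A graph is a non-oriented connected locally finite simple graph with nonempty edge set; a rooted graph $(\mathcal G,e)=(V,E,e)$. Orthogonal product: $\mathcal G\vdash\mathcal H$ for rooted graphs $(V_{\mathcal G},E_{\mathcal G},e_{\mathcal G})$, $(V_{\mathcal H},E_{\mathcal H},e_{\mathcal H})$ has vertex set $((V_{\mathcal G}\setminus\{e_{\mathcal G}\})\times V_{\mathcal H})\cup\{(e_{\mathcal G},e_{\mathcal H})\}$, root $(e_{\mathcal G},e_{\mathcal H})$, and edges $\{(x,e_{\mathcal H}),(x',e_{\mathcal H})\}$ for $\{x,x'\}\in E_{\mathcal G}$ and $\{(x,y),(x,y')\}$ for $x\ne e_{\mathcal G}$, $\{y,y'\}\in E_{\mathcal H}$. Inclusions: $\mathcal H\hookrightarrow\mathcal H\vdash\mathcal K$ via $y\mapsto(y,e_{\mathcal K})$; a root-preserving embedding $j:\mathcal H\to\mathcal H'$ induces $\mathcal G\vdash\mathcal H\to\mathcal G\vdash\mathcal H'$, $(x,y)\mapsto(x,j(y))$. With the convention $\mathcal G_2\vdash_0\mathcal G_1=\mathcal G_2$, the inclusions $\mathcal G_1\vdash_m\mathcal G_2\to\mathcal G_1\vdash_{m+1}\mathcal G_2$ are induced recursively from the inclusions $\mathcal G_2\vdash_{m-1}\mathcal G_1\to\mathcal G_2\vdash_m\mathcal G_1$ (starting from $\mathcal G_2\hookrightarrow\mathcal G_2\vdash\mathcal G_1$), and symmetrically; the inductive limit is the union of this chain of root-preserving embeddings. Free product $\mathcal G_1*\mathcal G_2$: vertices are the empty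 word $e$ and alternating words $v_1\cdots v_m$ with letters from $V_1\setminus\{e_1\}$ and $V_2\setminus\{e_2\}$ (consecutive letters from different sets; roots identified with the empty word), edges $\{vu,v'u\}$ with $\{v,v'\}\in E_1\cup E_2$ and $u,vu,v'u$ vertices. Branch subordinate to $\mathcal G_j$: $\mathcal B_j$ is the subgraph of $\mathcal G_1*\mathcal G_2$ induced on $S_j=\{e\}\cup\{$words whose last letter lies in $V_j\setminus\{e_j\}\}$, rooted at $e$. -}

module Defs where

open import Data.Nat using (ℕ; zero; suc; _≤′_; ≤′-refl; ≤′-step)
open import Data.Maybe using (Maybe; just; nothing)
import Data.Maybe as Maybe
open import Data.Product using (Σ; _×_; _,_; ∃)
open import Data.Unit using (⊤; tt)
open import Data.Empty using (⊥)
open import Data.List using (List)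
open import Data.List.Membership.Propositional using (_∈_)
open import Function.Bundles using (_⇔_)
open import Relation.Nullary using (¬_)
open import Relation.Binary.PropositionalEquality using (_≡_)

-- Convention: a rooted graph is given by the type N of its NON-ROOT
-- vertices; its vertex set is  Maybe N  and its root is  nothing .
-- (Every rooted graph (V,E,e) is of this form, with N = V ∖ {e}.)
-- The edge set is given as an adjacency relation Adj.

record RootedGraph : Set₁ where
  field
    N   : Set
    Adj : Maybe N → Maybe N → Set
open RootedGraph public

Vtx : RootedGraph → Set
Vtx G = Maybe (N G)

data Path (G : RootedGraph) : Vtx G → Vtx G → Set where
  here : ∀ {v} → Path G v v
  step : ∀ {u v w} → Adj G u v → Path G v w → Path G u w

record IsGraph (G : RootedGraph) : Set where
  field
    adj-sym      : ∀ {v w} → Adj G v w → Adj G w v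
    adj-irrefl   : ∀ {v} → ¬ Adj G v v
    adj-prop     : ∀ {v w} (p q : Adj G v w) → p ≡ q
    locallyFinite : ∀ v → Σ (List (Vtx G)) λ ns → ∀ w → (Adj G v w ⇔ (w ∈ ns))
    connected    : ∀ v w → Path G v w
    edge         : Σ (Vtx G) λ v → Σ (Vtx G) λ w → Adj G v w

-- Orthogonal product  G ⊢ H.
-- Non-root vertices: (V_G ∖ {e_G}) × V_H ; the root (e_G , e_H) is nothing.

ιˡ : ∀ {A B : Set} → Maybe A → Maybe (A × Maybe B)
ιˡ = Maybe.map (λ x → x , nothing)

data ⊢Adj (G H : RootedGraph) : Maybe (N G × Maybe (N H)) → Maybe (N G × Maybe (N H)) → Set where
  base  : ∀ {x x'} → Adj G x x' → ⊢Adj G H (ιˡ x) (ιˡ x')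
  fibre : ∀ (x : N G) {y y'} → Adj H y y' → ⊢Adj G H (just (x , y)) (just (x , y'))

_⊢_ : RootedGraph → RootedGraph → RootedGraph
N   (G ⊢ H) = N G × Maybe (N H)
Adj (G ⊢ H) = ⊢Adj G H

⊢[_] : ℕ → RootedGraph → RootedGraph → RootedGraph
⊢[ zero  ] A B = A
⊢[ suc m ] A B = A ⊢ ⊢[ m ] B A

-- the inclusions A ⊢_m B → A ⊢_(m+1) B (on non-root vertices; roots go to roots)
-- m = 0 : A ↪ A ⊢ B , y ↦ (y , e_B)
-- m+1   : induced by the inclusion B ⊢_m A → B ⊢_(m+1) A
inc : ∀ m A B → N (⊢[ m ] A B) → N (⊢[ suc m ] A B)
inc zero    A B y       = y , nothing
inc (suc m) A B (x , y) = x , Maybe.map (inc m B A) y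

record SRGraph : Set₁ where
  field
    Carrier : Set
    _≈_     : Carrier → Carrier → Set
    root    : Carrier
    Edge    : Carrier → Carrier → Set

record _≅_ (A B : SRGraph) : Set where
  private
    module A = SRGraph A
    module B = SRGraph B
  field
    to       : A.Carrier → B.Carrier
    from     : B.Carrier → A.Carrier
    to-cong  : ∀ {x y} → x A.≈ y → to x B.≈ to y
    from-cong : ∀ {x y} → x B.≈ y → from x A.≈ from y
    from-to  : ∀ x → from (to x) A.≈ x
    to-from  : ∀ y → to (from y) B.≈ y
    edges    : ∀ x y → A.Edge x y ⇔ B.Edge (to x) (to y)
    root-pres : to A.root B.≈ B.root

module _ (A B : RootedGraph) where

  level : ℕ → RootedGraph
  level k = ⊢[ suc k ] A B

  up : ∀ {k n} → k ≤′ n → Vtx (level k) → Vtx (level n)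
  up ≤′-refl       x = x
  up (≤′-step {n} p) x = Maybe.map (inc (suc n) A B) (up p x)

  -- the union of the chain: pairs (level, vertex) identified along the embeddings
  Limit : SRGraph
  Limit = record
    { Carrier = Σ ℕ λ k → Vtx (level k)
    ; _≈_ = λ { (k , x) (k' , x') → ∃ λ n → Σ (k ≤′ n) λ p → Σ (k' ≤′ n) λ q →
                  up p x ≡ up q x' }
    ; root = 0 , nothing
    ; Edge = λ { (k , x) (k' , x') → ∃ λ n → Σ (k ≤′ n) λ p → Σ (k' ≤′ n) λ q →
                  Adj (level n) (up p x) (up q x') }
    }

data Side : Set where
  s₁ s₂ : Side

other : Side → Side
other s₁ = s₂
other s₂ = s₁

module _ (G : Side → RootedGraph) where

  -- nonempty alternating words whose FIRST letter is from side s
  data NWord : Side → Set where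
    sing : ∀ {s} → N (G s) → NWord s
    cons : ∀ {s} → N (G s) → NWord (other s) → NWord s

  -- vertices of G s₁ * G s₂ ; nothing is the empty word e
  Word : Set
  Word = Maybe (Σ Side NWord)

  lastSide : ∀ {s} → NWord s → Side
  lastSide (sing {s} _) = s
  lastSide (cons _ t)   = lastSide t

  -- v u  for v ∈ V_s (v = e_s gives u) and u a word not starting with a letter of side s
  prepend : ∀ s → Maybe (N (G s)) → Maybe (NWord (other s)) → Word
  prepend s nothing  nothing  = nothing
  prepend s nothing  (just t) = just (other s , t)
  prepend s (just a) nothing  = just (s , sing a)
  prepend s (just a) (just t) = just (s , cons a t)

  data FPAdj : Word → Word → Set where
    edge : ∀ s {v v'} → Adj (G s) v v' → (u : Maybe (NWord (other s))) →
           FPAdj (prepend s v u) (prepend s v' u)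

  -- S_j : the empty word and words whose last letter lies in V_j ∖ {e_j}
  InBranch : Side → Word → Set
  InBranch j nothing        = ⊤
  InBranch j (just (s , t)) = lastSide t ≡ j

  Branch : Side → SRGraph
  Branch j = record
    { Carrier = Σ Word (InBranch j)
    ; _≈_ = _≡_
    ; root = nothing , tt
    ; Edge = λ x y → FPAdj (Data.Product.proj₁ x) (Data.Product.proj₁ y)
    }

-- Reading a vertex of G₁ ⊢ₘ G₂ from the outside in gives an alternating word whose
-- first letter lies in G₁, and the embeddings of the chain preserve this reading.  So
-- the inductive limit is the graph of all such words, an edge changing the last letter
-- along an edge of its factor.  Reversing words identifies this graph with the branch
-- B₁, whose words end with a letter of G₁ and whose edges change the first letter.
module Submission where

open import Defs
open import Data.Nat using (ℕ; zero; suc; _≤′_; ≤′-refl; ≤′-step; _⊔_)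
open import Data.Nat.Properties using (≤⇒≤′; m≤m⊔n; m≤n⊔m)
open import Data.Maybe using (Maybe; just; nothing)
import Data.Maybe as Maybe
open import Data.Maybe.Properties using (just-injective)
open import Data.Product using (Σ; _×_; _,_; proj₁)
open import Data.Unit using (tt)
open import Data.Empty using (⊥-elim)
open import Function.Bundles using (mk⇔; Equivalence)
open import Relation.Nullary using (¬_)
open import Relation.Binary.PropositionalEquality
  using (_≡_; refl; sym; trans; cong; cong₂; subst; subst₂)
open import Axiom.UniquenessOfIdentityProofs.WithK using (uip)

≅-trans : ∀ {A B C} → (∀ {x y} → SRGraph._≈_ B x y → x ≡ y) →
          A ≅ B → B ≅ C → A ≅ C
≅-trans {A} {B} {C} ≈⇒≡ f g = record
  { to        = λ x → G.to (F.to x)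
  ; from      = λ z → F.from (G.from z)
  ; to-cong   = λ e → G.to-cong (F.to-cong e)
  ; from-cong = λ e → F.from-cong (G.from-cong e)
  ; from-to   = λ x → subst (λ y → A._≈_ (F.from y) x) (sym (≈⇒≡ (G.from-to (F.to x)))) (F.from-to x)
  ; to-from   = λ z → subst (λ y → C._≈_ (G.to y) z) (sym (≈⇒≡ (F.to-from (G.from z)))) (G.to-from z)
  ; edges     = λ x y → mk⇔ (λ e → Equivalence.to (G.edges _ _) (Equivalence.to (F.edges x y) e))
                             (λ e → Equivalence.from (F.edges x y) (Equivalence.from (G.edges _ _) e))
  ; root-pres = subst (λ y → C._≈_ (G.to y) C.root) (sym (≈⇒≡ F.root-pres)) G.root-pres
  }
  where
  module A = SRGraph A
  module C = SRGraph C
  module F = _≅_ f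
  module G = _≅_ g

≤′-⊔ˡ : ∀ k k' → k ≤′ k ⊔ k'
≤′-⊔ˡ k k' = ≤⇒≤′ (m≤m⊔n k k')

≤′-⊔ʳ : ∀ k k' → k' ≤′ k ⊔ k'
≤′-⊔ʳ k k' = ≤⇒≤′ (m≤n⊔m k k')

module _ (G : Side → RootedGraph) where

  data Alt : Side → Side → Set where
    _∷_ : ∀ {s t} → N (G s) → Maybe (Alt t s) → Alt s t

  [_] : ∀ {s t} → N (G s) → Alt s t
  [ a ] = a ∷ nothing

  ∷-injective : ∀ {s t} {a a' : N (G s)} {y y' : Maybe (Alt t s)} →
                a ∷ y ≡ a' ∷ y' → a ≡ a' × y ≡ y'
  ∷-injective refl = refl , refl

  data AltAdj : ∀ s t → Maybe (Alt s t) → Maybe (Alt s t) → Set where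
    base  : ∀ {s t v v'} → Adj (G s) v v' → AltAdj s t (Maybe.map [_] v) (Maybe.map [_] v')
    fibre : ∀ {s t} (a : N (G s)) {y y'} → AltAdj t s y y' → AltAdj s t (just (a ∷ y)) (just (a ∷ y'))

  AltGraph : Side → Side → SRGraph
  AltGraph s t = record
    { Carrier = Maybe (Alt s t) ; _≈_ = _≡_ ; root = nothing ; Edge = AltAdj s t }

  read : ∀ m s t → N (⊢[ m ] (G s) (G t)) → Alt s t
  read zero    s t a       = [ a ]
  read (suc m) s t (a , y) = a ∷ Maybe.map (read m t s) y

  readᵛ : ∀ m s t → Vtx (⊢[ m ] (G s) (G t)) → Maybe (Alt s t)
  readᵛ m s t = Maybe.map (read m s t)

  read-inc  : ∀ m s t x → read (suc m) s t (inc m (G s) (G t) x) ≡ read m s t x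
  readᵛ-inc : ∀ m s t x → readᵛ (suc m) s t (Maybe.map (inc m (G s) (G t)) x) ≡ readᵛ m s t x

  read-inc zero    s t x       = refl
  read-inc (suc m) s t (a , y) = cong (a ∷_) (readᵛ-inc m t s y)

  readᵛ-inc m s t nothing  = refl
  readᵛ-inc m s t (just x) = cong just (read-inc m s t x)

  readᵛ-up : ∀ {s t k n} (p : k ≤′ n) x →
             readᵛ (suc n) s t (up (G s) (G t) p x) ≡ readᵛ (suc k) s t x
  readᵛ-up ≤′-refl                 x = refl
  readᵛ-up {s} {t} (≤′-step {n} p) x = trans (readᵛ-inc (suc n) s t (up (G s) (G t) p x)) (readᵛ-up p x)

  read-injective  : ∀ m s t {x x'} → read m s t x ≡ read m s t x' → x ≡ x'
  readᵛ-injective : ∀ m s t {x x'} → readᵛ m s t x ≡ readᵛ m s t x' → x ≡ x'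

  read-injective zero    s t refl = refl
  read-injective (suc m) s t e =
    let (a≡a' , y≡y') = ∷-injective e in cong₂ _,_ a≡a' (readᵛ-injective m t s y≡y')

  readᵛ-injective m s t {nothing} {nothing} e = refl
  readᵛ-injective m s t {nothing} {just _}  ()
  readᵛ-injective m s t {just _}  {nothing} ()
  readᵛ-injective m s t {just x}  {just x'} e = cong just (read-injective m s t (just-injective e))

  depth : ∀ {s t} → Maybe (Alt s t) → ℕ
  depth nothing        = zero
  depth (just (a ∷ y)) = suc (depth y)

  embed : ∀ {s t} (o : Maybe (Alt s t)) → Vtx (level (G s) (G t) (depth o))
  embed nothing        = nothing
  embed (just (a ∷ y)) = just (a , embed y)

  readᵛ-embed : ∀ {s t} (o : Maybe (Alt s t)) → readᵛ (suc (depth o)) s t (embed o) ≡ o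
  readᵛ-embed nothing        = refl
  readᵛ-embed (just (a ∷ y)) = cong (λ z → just (a ∷ z)) (readᵛ-embed y)

  ι : ∀ m {s t} → Maybe (N (G s)) → Vtx (⊢[ m ] (G s) (G t))
  ι zero    v = v
  ι (suc m) v = ιˡ v

  readᵛ-ι : ∀ m s t v → readᵛ m s t (ι m v) ≡ Maybe.map [_] v
  readᵛ-ι zero    s t v        = refl
  readᵛ-ι (suc m) s t nothing  = refl
  readᵛ-ι (suc m) s t (just a) = refl

  ι-adj : ∀ m {s t v v'} → Adj (G s) v v' → Adj (⊢[ m ] (G s) (G t)) (ι m v) (ι m v')
  ι-adj zero    h = h
  ι-adj (suc m) h = base h

  readᵛ-adj : ∀ m s t {x x'} → Adj (⊢[ m ] (G s) (G t)) x x' →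
              AltAdj s t (readᵛ m s t x) (readᵛ m s t x')
  readᵛ-adj zero    s t h                   = base h
  readᵛ-adj (suc m) s t (base {v} {v'} h)   =
    subst₂ (AltAdj s t) (sym (readᵛ-ι (suc m) s t v)) (sym (readᵛ-ι (suc m) s t v')) (base h)
  readᵛ-adj (suc m) s t (fibre a h)         = fibre a (readᵛ-adj m t s h)

  module _ (irreflexive : ∀ s {v} → ¬ Adj (G s) v v) where

    adj-readᵛ : ∀ {s t o o'} → AltAdj s t o o' → ∀ m {x x'} →
                o ≡ readᵛ m s t x → o' ≡ readᵛ m s t x' → Adj (⊢[ m ] (G s) (G t)) x x'
    adj-readᵛ {s} {t} (base {v = v} {v'} h) m e e' =
      subst₂ (Adj (⊢[ m ] (G s) (G t))) (ι-unique e) (ι-unique e') (ι-adj m h)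
      where
      ι-unique : ∀ {w x} → Maybe.map [_] w ≡ readᵛ m s t x → ι m w ≡ x
      ι-unique {w} e = readᵛ-injective m s t (trans (readᵛ-ι m s t w) e)
    -- at level 0 a fibre edge would join the root of the fibre to itself
    adj-readᵛ (fibre a h) zero {just _}  {just _}  refl refl =
      ⊥-elim (irreflexive _ (adj-readᵛ h zero {nothing} {nothing} refl refl))
    adj-readᵛ (fibre a h) zero {nothing} ()
    adj-readᵛ (fibre a h) zero {just _}  {nothing} _ ()
    adj-readᵛ (fibre a h) (suc m) {just _} {just _} refl refl = fibre a (adj-readᵛ h m refl refl)
    adj-readᵛ (fibre a h) (suc m) {nothing} ()
    adj-readᵛ (fibre a h) (suc m) {just _}  {nothing} _ ()

  module _ (s t : Side) where
    private
      module L = SRGraph (Limit (G s) (G t))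

    ≈-readᵛ : ∀ {k k' x x'} → (k , x) L.≈ (k' , x') → readᵛ (suc k) s t x ≡ readᵛ (suc k') s t x'
    ≈-readᵛ {x = x} {x'} (n , p , q , e) =
      trans (sym (readᵛ-up p x)) (trans (cong (readᵛ (suc n) s t) e) (readᵛ-up q x'))

    readᵛ-≈ : ∀ {k k' x x'} → readᵛ (suc k) s t x ≡ readᵛ (suc k') s t x' → (k , x) L.≈ (k' , x')
    readᵛ-≈ {k} {k'} {x} {x'} e =
      k ⊔ k' , p , q , readᵛ-injective (suc (k ⊔ k')) s t (trans (readᵛ-up p x) (trans e (sym (readᵛ-up q x'))))
      where
      p : k ≤′ k ⊔ k'
      p = ≤′-⊔ˡ k k'
      q : k' ≤′ k ⊔ k'
      q = ≤′-⊔ʳ k k'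

    Edge-readᵛ : ∀ {k k' x x'} → L.Edge (k , x) (k' , x') →
                 AltAdj s t (readᵛ (suc k) s t x) (readᵛ (suc k') s t x')
    Edge-readᵛ {x = x} {x'} (n , p , q , h) =
      subst₂ (AltAdj s t) (readᵛ-up p x) (readᵛ-up q x') (readᵛ-adj (suc n) s t h)

    readᵛ-Edge : (∀ s {v} → ¬ Adj (G s) v v) → ∀ {k k' x x'} →
                 AltAdj s t (readᵛ (suc k) s t x) (readᵛ (suc k') s t x') → L.Edge (k , x) (k' , x')
    readᵛ-Edge irreflexive {k} {k'} {x} {x'} h =
      k ⊔ k' , p , q , adj-readᵛ irreflexive h (suc (k ⊔ k')) (sym (readᵛ-up p x)) (sym (readᵛ-up q x'))
      where
      p : k ≤′ k ⊔ k'
      p = ≤′-⊔ˡ k k'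
      q : k' ≤′ k ⊔ k'
      q = ≤′-⊔ʳ k k'

    AltGraph≅Limit : (∀ s {v} → ¬ Adj (G s) v v) → AltGraph s t ≅ Limit (G s) (G t)
    AltGraph≅Limit irreflexive = record
      { to        = λ o → depth o , embed o
      ; from      = λ { (k , x) → readᵛ (suc k) s t x }
      ; to-cong   = λ { refl → readᵛ-≈ refl }
      ; from-cong = ≈-readᵛ
      ; from-to   = readᵛ-embed
      ; to-from   = λ { (k , x) → readᵛ-≈ (readᵛ-embed (readᵛ (suc k) s t x)) }
      ; edges     = λ o o' → mk⇔
          (λ h → readᵛ-Edge irreflexive (subst₂ (AltAdj s t) (sym (readᵛ-embed o)) (sym (readᵛ-embed o')) h))
          (λ e → subst₂ (AltAdj s t) (readᵛ-embed o) (readᵛ-embed o') (Edge-readᵛ e))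
      ; root-pres = readᵛ-≈ refl
      }

  _◃_ : ∀ {s} → N (G s) → Maybe (NWord G (other s)) → NWord G s
  a ◃ nothing = sing a
  a ◃ just w  = cons a w

  rev : ∀ {s} (w : NWord G s) → Maybe (Alt (other s) s) → Alt (lastSide G w) (other (lastSide G w))
  rev (sing a)        acc = a ∷ acc
  rev {s₁} (cons a w) acc = rev w (just (a ∷ acc))
  rev {s₂} (cons a w) acc = rev w (just (a ∷ acc))

  unrev : ∀ {s} → Maybe (Alt s (other s)) → Maybe (NWord G (other s)) → Word G
  unrev {s}  nothing        u = prepend G s nothing u
  unrev {s₁} (just (a ∷ y)) u = unrev y (just (a ◃ u))
  unrev {s₂} (just (a ∷ y)) u = unrev y (just (a ◃ u))

  -- unrev acc (just w), retyped: other (other s) is not definitionally s.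
  unrev-just : ∀ {s} → Maybe (Alt (other s) s) → NWord G s → Word G
  unrev-just {s₁} acc w = unrev acc (just w)
  unrev-just {s₂} acc w = unrev acc (just w)

  unrev-rev : ∀ {s} (w : NWord G s) acc → unrev (just (rev w acc)) nothing ≡ unrev-just acc w
  unrev-rev {s₁} (sing a)   acc = refl
  unrev-rev {s₂} (sing a)   acc = refl
  unrev-rev {s₁} (cons a w) acc = unrev-rev w (just (a ∷ acc))
  unrev-rev {s₂} (cons a w) acc = unrev-rev w (just (a ∷ acc))

  unrev∘rev : ∀ {s} (w : NWord G s) → unrev (just (rev w nothing)) nothing ≡ just (s , w)
  unrev∘rev {s₁} w = unrev-rev w nothing
  unrev∘rev {s₂} w = unrev-rev w nothing

  revW : Word G → Maybe (Σ Side λ k → Alt k (other k))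
  revW nothing        = nothing
  revW (just (s , w)) = just (lastSide G w , rev w nothing)

  revOnto : ∀ {s} → Maybe (NWord G (other s)) → Maybe (Alt s (other s)) → Maybe (Σ Side λ k → Alt k (other k))
  revOnto {s}  nothing  o = Maybe.map (s ,_) o
  revOnto {s₁} (just w) o = just (_ , rev w o)
  revOnto {s₂} (just w) o = just (_ , rev w o)

  revW-unrev : ∀ {s} (o : Maybe (Alt s (other s))) u → revW (unrev o u) ≡ revOnto u o
  revW-unrev       nothing        nothing  = refl
  revW-unrev {s₁}  nothing        (just w) = refl
  revW-unrev {s₂}  nothing        (just w) = refl
  revW-unrev {s₁} (just (a ∷ y)) nothing  = revW-unrev y (just (sing a))
  revW-unrev {s₁} (just (a ∷ y)) (just w) = revW-unrev y (just (cons a w))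
  revW-unrev {s₂} (just (a ∷ y)) nothing  = revW-unrev y (just (sing a))
  revW-unrev {s₂} (just (a ∷ y)) (just w) = revW-unrev y (just (cons a w))

  InBranch-irrelevant : ∀ {j} w (p q : InBranch G j w) → p ≡ q
  InBranch-irrelevant nothing  tt tt = refl
  InBranch-irrelevant (just _) p  q  = uip p q

  branch-≡ : ∀ {j} {x y : SRGraph.Carrier (Branch G j)} → proj₁ x ≡ proj₁ y → x ≡ y
  branch-≡ {x = w , p} {.w , q} refl = cong (w ,_) (InBranch-irrelevant w p q)

  toAlt : ∀ {j} → SRGraph.Carrier (Branch G j) → Maybe (Alt j (other j))
  toAlt (nothing , _)          = nothing
  toAlt (just (s , w) , refl) = just (rev w nothing)

  revW-InBranch : ∀ {j w} {o : Alt j (other j)} → revW w ≡ just (j , o) → InBranch G j w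
  revW-InBranch {w = nothing}       ()
  revW-InBranch {w = just (s , w)} e = cong proj₁ (just-injective e)

  revW-toAlt : ∀ {j w} {o : Alt j (other j)} → revW w ≡ just (j , o) → (p : InBranch G j w) → toAlt (w , p) ≡ just o
  revW-toAlt {w = nothing}       ()
  revW-toAlt {w = just (s , w)} refl refl = refl

  unrev-InBranch : ∀ {j} (o : Maybe (Alt j (other j))) → InBranch G j (unrev o nothing)
  unrev-InBranch nothing  = tt
  unrev-InBranch (just o) = revW-InBranch (revW-unrev (just o) nothing)

  fromAlt : ∀ {j} → Maybe (Alt j (other j)) → SRGraph.Carrier (Branch G j)
  fromAlt o = unrev o nothing , unrev-InBranch o

  toAlt-fromAlt : ∀ {j} (o : Maybe (Alt j (other j))) → toAlt (fromAlt o) ≡ o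
  toAlt-fromAlt nothing  = refl
  toAlt-fromAlt (just o) = revW-toAlt (revW-unrev (just o) nothing) (unrev-InBranch (just o))

  unrev-toAlt : ∀ {j} (x : SRGraph.Carrier (Branch G j)) → unrev (toAlt x) nothing ≡ proj₁ x
  unrev-toAlt (nothing , tt)          = refl
  unrev-toAlt (just (s , w) , refl) = unrev∘rev w

  rev-adj : ∀ {s} (w : NWord G s) {acc acc'} → AltAdj (other s) s acc acc' →
            AltAdj (lastSide G w) (other (lastSide G w)) (just (rev w acc)) (just (rev w acc'))
  rev-adj (sing a)        h = fibre a h
  rev-adj {s₁} (cons a w) h = rev-adj w (fibre a h)
  rev-adj {s₂} (cons a w) h = rev-adj w (fibre a h)

  unrev-[] : ∀ {s} v u → unrev {s} (Maybe.map [_] v) u ≡ prepend G s v u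
  unrev-[]       nothing  u        = refl
  unrev-[] {s₁} (just a) nothing  = refl
  unrev-[] {s₁} (just a) (just w) = refl
  unrev-[] {s₂} (just a) nothing  = refl
  unrev-[] {s₂} (just a) (just w) = refl

  unrev-adj : ∀ {s o o'} → AltAdj s (other s) o o' → ∀ u → FPAdj G (unrev o u) (unrev o' u)
  unrev-adj {s}  (base {v = v} {v'} h) u =
    subst₂ (FPAdj G) (sym (unrev-[] v u)) (sym (unrev-[] v' u)) (edge s h u)
  unrev-adj {s₁} (fibre a h) u = unrev-adj h (just (a ◃ u))
  unrev-adj {s₂} (fibre a h) u = unrev-adj h (just (a ◃ u))

  module _ (irreflexive : ∀ s {v} → ¬ Adj (G s) v v) where

    toAlt-edge : ∀ {j} s {v v'} → Adj (G s) v v' → (u : Maybe (NWord G (other s)))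
                 (p : InBranch G j (prepend G s v u)) (p' : InBranch G j (prepend G s v' u)) →
                 AltAdj j (other j) (toAlt (prepend G s v u , p)) (toAlt (prepend G s v' u , p'))
    toAlt-edge s  {nothing} {nothing} h nothing _    _    = ⊥-elim (irreflexive s h)
    toAlt-edge s  {nothing} {just _}  h nothing tt   refl = base h
    toAlt-edge s  {just _}  {nothing} h nothing refl tt   = base h
    toAlt-edge s  {just _}  {just _}  h nothing refl refl = base h
    toAlt-edge s₁ {nothing} {nothing} h (just w) refl refl = rev-adj w (base h)
    toAlt-edge s₁ {nothing} {just _}  h (just w) refl refl = rev-adj w (base h)
    toAlt-edge s₁ {just _}  {nothing} h (just w) refl refl = rev-adj w (base h)
    toAlt-edge s₁ {just _}  {just _}  h (just w) refl refl = rev-adj w (base h)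
    toAlt-edge s₂ {nothing} {nothing} h (just w) refl refl = rev-adj w (base h)
    toAlt-edge s₂ {nothing} {just _}  h (just w) refl refl = rev-adj w (base h)
    toAlt-edge s₂ {just _}  {nothing} h (just w) refl refl = rev-adj w (base h)
    toAlt-edge s₂ {just _}  {just _}  h (just w) refl refl = rev-adj w (base h)

    toAlt-adj : ∀ {j} (x y : SRGraph.Carrier (Branch G j)) →
                FPAdj G (proj₁ x) (proj₁ y) → AltAdj j (other j) (toAlt x) (toAlt y)
    toAlt-adj (_ , p) (_ , p') (edge s h u) = toAlt-edge s h u p p'

    Branch≅AltGraph : ∀ j → Branch G j ≅ AltGraph j (other j)
    Branch≅AltGraph j = record
      { to        = toAlt
      ; from      = fromAlt
      ; to-cong   = cong toAlt
      ; from-cong = cong fromAlt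
      ; from-to   = λ x → branch-≡ (unrev-toAlt x)
      ; to-from   = toAlt-fromAlt
      ; edges     = λ x y → mk⇔ (toAlt-adj x y)
          (λ h → subst₂ (FPAdj G) (unrev-toAlt x) (unrev-toAlt y) (unrev-adj h nothing))
      ; root-pres = refl
      }

theorem7p2 : (G : Side → RootedGraph) → (∀ s → IsGraph (G s)) →
    ∀ j → Branch G j ≅ Limit (G j) (G (other j))
theorem7p2 G isGraph j =
  ≅-trans (λ e → e) (Branch≅AltGraph G irreflexive j) (AltGraph≅Limit G j (other j) irreflexive)
  where
  irreflexive : ∀ s {v} → ¬ Adj (G s) v v
  irreflexive s = IsGraph.adj-irrefl (isGraph s)
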